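{- In the proof system $\mathsf{C}(\ast)^-$ obtained from $\mathsf{C}(\ast)$ by removing the axiom schemata (5) and (6), every instance of (5) $\mathrm{size}\ge\beta+1\Rightarrow\mathrm{size}\ge\beta$ ($\beta\in\mathbb{N}$) and of (6) $\bigwedge_{x\in X}(\mathrm{alloc}(x)\wedge\bigwedge_{y\in X\setminus\{x\}}\neg(x=y))\Rightarrow\mathrm{size}\ge|X|$ ($X\subseteq\mathrm{PVAR}$ finite) is derivable; i.e., these axioms are derivable in $\mathsf{C}(\ast)$ from its other axioms and rules.
   Context: Logic $\mathrm{SL}(\ast,\mathrm{alloc})$: fix a countably infinite set $\mathrm{PVAR}$ of program variables. Formulae: $\varphi ::= x = y \mid x \hookrightarrow y \mid \mathrm{emp}\mid \mathrm{alloc}(x) \mid \neg\varphi \mid \varphi\wedge\varphi \mid \varphi \ast \varphi$ ($x,y\in\mathrm{PVAR}$). Abbreviations: $\bot:=\neg(x=x)$, $\top:=\neg\bot$, $\mathrm{size}\ge0:=\top$, $\mathrm{size}\ge1:=\neg\mathrm{emp}$, $\mathrm{size}\ge\beta:=\neg\mathrm{emp}\ast\mathrm{size}\ge\beta-1$ for $\beta\ge2$; $\mathrm{size}=\beta:=\mathrm{size}\ge\beta\wedge\neg\,\mathrm{size}\ge\beta+1$; $a\dot-b=\max(0,a-b)$. The proof system $\mathsf{C}(\ast)$ (derivability is the least set of formulae containing all instances of the axiom schemata, metavariables ranging over formulae, variables, naturals and finite sets of variables, and closed under the rules) consists of all axiom schemata of classical propositional calculus, modus ponens, and: (1) $x=x$;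 (2) $\varphi\wedge x=y\Rightarrow\varphi'$, where $\varphi'$ is obtained from $\varphi$ by replacing every occurrence of $y$ with $x$; (3) $x\hookrightarrow y\Rightarrow\mathrm{alloc}(x)$; (4) $(x\hookrightarrow y\wedge x\hookrightarrow z)\Rightarrow y=z$; (5) $\mathrm{size}\ge\beta+1\Rightarrow\mathrm{size}\ge\beta$; (6) $\bigwedge_{x\in X}(\mathrm{alloc}(x)\wedge\bigwedge_{y\in X\setminus\{x\}}\neg(x=y))\Rightarrow\mathrm{size}\ge|X|$ for finite $X$; (7) $(\varphi\ast\psi)\Leftrightarrow(\psi\ast\varphi)$; (8) $((\varphi\ast\psi)\ast\chi)\Leftrightarrow(\varphi\ast(\psi\ast\chi))$; (9) $((\varphi\vee\psi)\ast\chi)\Rightarrow((\varphi\ast\chi)\vee(\psi\ast\chi))$; (10) $(\bot\ast\varphi)\Leftrightarrow\bot$; (11) $\varphi\Leftrightarrow(\varphi\ast\mathrm{emp})$; (12) $(\mathrm{alloc}(x)\ast\top)\Rightarrow\mathrm{alloc}(x)$; (13) $(\mathrm{alloc}(x)\ast\mathrm{alloc}(x))\Leftrightarrow\bot$; (14) $(\xi\ast\top)\Rightarrow\xi$ for $\xi\in\{\neg\mathrm{emp},\ x=y,\ \neg(x=y),\ x\hookrightarrow y\}$; (15) $(\neg\mathrm{alloc}(x)\ast\neg\mathrm{alloc}(x))\Rightarrow\neg\mathrm{alloc}(x)$; (16) $((\mathrm{alloc}(x)\wedge\neg x\hookrightarrow y)\ast\top)\Rightarrow\neg x\hookrightarrow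 y$; (17) $\mathrm{alloc}(x)\Rightarrow((\mathrm{alloc}(x)\wedge\mathrm{size}=1)\ast\top)$; (18) $\neg\mathrm{emp}\Rightarrow(\mathrm{size}=1\ast\top)$; (19) $(\neg\,\mathrm{size}\ge\beta_1\ast\neg\,\mathrm{size}\ge\beta_2)\Rightarrow\neg\,\mathrm{size}\ge\beta_1+\beta_2\dot-1$; (20) $(\mathrm{alloc}(x)\wedge\mathrm{alloc}(y)\wedge\neg(x=y))\Rightarrow\mathrm{size}\ge2$; and the rule: from $\varphi\Rightarrow\chi$ infer $(\varphi\ast\psi)\Rightarrow(\chi\ast\psi)$. -}

module Defs where

open import Data.Nat using (ℕ; zero; suc; _+_; _∸_)
open import Data.Bool using (Bool; true; false; not; _∧_)
open import Data.List using (List; []; _∷_; length; filter; map)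
open import Data.List.Relation.Unary.Unique.Propositional using (Unique)
open import Relation.Nullary using (¬_; ¬?)
open import Relation.Nullary.Decidable using (⌊_⌋)
open import Relation.Binary.PropositionalEquality using (_≡_)
import Data.Nat as ℕ

PVAR : Set
PVAR = ℕ

infixr 6 _∗_
infixr 5 _∧'_
data Form : Set where
  _≐_   : PVAR → PVAR → Form
  _↪_   : PVAR → PVAR → Form
  emp   : Form
  alloc : PVAR → Form
  ¬'_   : Form → Form
  _∧'_  : Form → Form → Form
  _∗_   : Form → Form → Form

infixr 4 _∨'_
infixr 3 _⇒_ _⇔_
_∨'_ : Form → Form → Form
φ ∨' ψ = ¬' (¬' φ ∧' ¬' ψ)

_⇒_ : Form → Form → Form
φ ⇒ ψ = ¬' (φ ∧' ¬' ψ)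

_⇔_ : Form → Form → Form
φ ⇔ ψ = (φ ⇒ ψ) ∧' (ψ ⇒ φ)

⊥' : Form
⊥' = ¬' (0 ≐ 0)

⊤' : Form
⊤' = ¬' ⊥'

size≥ : ℕ → Form
size≥ zero = ⊤'
size≥ (suc zero) = ¬' emp
size≥ (suc (suc β)) = ¬' emp ∗ size≥ (suc β)

size≐ : ℕ → Form
size≐ β = size≥ β ∧' ¬' size≥ (suc β)

⋀ : List Form → Form
⋀ [] = ⊤'
⋀ (φ ∷ φs) = φ ∧' ⋀ φs

rn : PVAR → PVAR → PVAR → PVAR
rn y x z with ⌊ z ℕ.≟ y ⌋
... | true = x
... | false = z

_[_↦_] : Form → PVAR → PVAR → Form
(a ≐ b) [ y ↦ x ] = rn y x a ≐ rn y x b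
(a ↪ b) [ y ↦ x ] = rn y x a ↪ rn y x b
emp [ y ↦ x ] = emp
alloc a [ y ↦ x ] = alloc (rn y x a)
(¬' φ) [ y ↦ x ] = ¬' (φ [ y ↦ x ])
(φ ∧' ψ) [ y ↦ x ] = (φ [ y ↦ x ]) ∧' (ψ [ y ↦ x ])
(φ ∗ ψ) [ y ↦ x ] = (φ [ y ↦ x ]) ∗ (ψ [ y ↦ x ])

-- Classical propositional calculus: a formula is an instance of a
-- propositional tautology iff it evaluates to true under every Boolean
-- valuation of its propositional atoms (the maximal subformulae whose
-- main connective is not ¬ or ∧).
evalB : (Form → Bool) → Form → Bool
evalB v (¬' φ) = not (evalB v φ)
evalB v (φ ∧' ψ) = evalB v φ ∧ evalB v ψ
evalB v φ = v φ

Taut : Form → Set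
Taut φ = ∀ (v : Form → Bool) → evalB v φ ≡ true

without : PVAR → List PVAR → List PVAR
without x = filter (λ y → ¬? (y ℕ.≟ x))

allocDistinct : List PVAR → Form
allocDistinct X =
  ⋀ (map (λ x → alloc x ∧' ⋀ (map (λ y → ¬' (x ≐ y)) (without x X))) X)

-- Derivability in C(∗)⁻ : C(∗) without axiom schemata (5) and (6).
infix 2 ⊢⁻_
data ⊢⁻_ : Form → Set where
  taut : ∀ {φ} → Taut φ → ⊢⁻ φ
  mp   : ∀ {φ ψ} → ⊢⁻ φ → ⊢⁻ (φ ⇒ ψ) → ⊢⁻ ψ
  ax1  : ∀ x → ⊢⁻ x ≐ x
  ax2  : ∀ φ x y → ⊢⁻ (φ ∧' x ≐ y) ⇒ (φ [ y ↦ x ])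
  ax3  : ∀ x y → ⊢⁻ x ↪ y ⇒ alloc x
  ax4  : ∀ x y z → ⊢⁻ (x ↪ y ∧' x ↪ z) ⇒ y ≐ z
  ax7  : ∀ φ ψ → ⊢⁻ (φ ∗ ψ) ⇔ (ψ ∗ φ)
  ax8  : ∀ φ ψ χ → ⊢⁻ ((φ ∗ ψ) ∗ χ) ⇔ (φ ∗ (ψ ∗ χ))
  ax9  : ∀ φ ψ χ → ⊢⁻ ((φ ∨' ψ) ∗ χ) ⇒ ((φ ∗ χ) ∨' (ψ ∗ χ))
  ax10 : ∀ φ → ⊢⁻ (⊥' ∗ φ) ⇔ ⊥'
  ax11 : ∀ φ → ⊢⁻ φ ⇔ (φ ∗ emp)
  ax12 : ∀ x → ⊢⁻ (alloc x ∗ ⊤') ⇒ alloc x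
  ax13 : ∀ x → ⊢⁻ (alloc x ∗ alloc x) ⇔ ⊥'
  ax14a : ⊢⁻ (¬' emp ∗ ⊤') ⇒ ¬' emp
  ax14b : ∀ x y → ⊢⁻ ((x ≐ y) ∗ ⊤') ⇒ (x ≐ y)
  ax14c : ∀ x y → ⊢⁻ (¬' (x ≐ y) ∗ ⊤') ⇒ ¬' (x ≐ y)
  ax14d : ∀ x y → ⊢⁻ ((x ↪ y) ∗ ⊤') ⇒ (x ↪ y)
  ax15 : ∀ x → ⊢⁻ (¬' alloc x ∗ ¬' alloc x) ⇒ ¬' alloc x
  ax16 : ∀ x y → ⊢⁻ ((alloc x ∧' ¬' (x ↪ y)) ∗ ⊤') ⇒ ¬' (x ↪ y)
  ax17 : ∀ x → ⊢⁻ alloc x ⇒ ((alloc x ∧' size≐ 1) ∗ ⊤')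
  ax18 : ⊢⁻ ¬' emp ⇒ (size≐ 1 ∗ ⊤')
  ax19 : ∀ β₁ β₂ → ⊢⁻ (¬' size≥ β₁ ∗ ¬' size≥ β₂) ⇒ ¬' size≥ (β₁ + β₂ ∸ 1)
  ax20 : ∀ x y → ⊢⁻ (alloc x ∧' alloc y ∧' ¬' (x ≐ y)) ⇒ size≥ 2
  ∗-mono : ∀ {φ χ} ψ → ⊢⁻ φ ⇒ χ → ⊢⁻ (φ ∗ ψ) ⇒ (χ ∗ ψ)

module Submission where

-- (5) follows by induction on β from ¬emp ∗ ⊤ ⇒ ¬emp.
-- (6): call X triangular when every variable is allocated and distinct
-- from all later ones.  Axiom (17) splits off a one-cell heap at the first
-- variable x; the rest of the heap still satisfies the triangular form of
-- the remaining variables, since a cell at x allocates no other address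
-- (axiom (20)) and pure facts are frame-independent.  Each variable thus
-- contributes a ¬emp conjunct, giving size≥|X|.  For duplicate-free X the
-- antecedent of (6) implies the triangular form of X.

open import Defs
open import Data.Nat using (ℕ; zero; suc; _+_; _≟_)
open import Data.Fin using (Fin; zero; suc)
open import Data.Bool using (Bool; true; false; not; _∧_; T)
open import Data.Bool.Properties using (T-∧; T-≡)
open import Data.Vec using (Vec; []; _∷_; lookup)
import Data.Vec as Vec
open import Data.Vec.Properties using (lookup-map)
open import Data.List using (List; []; _∷_; length; map)
open import Data.List.Relation.Unary.All using (All)
import Data.List.Relation.Unary.All as All
open import Data.List.Relation.Unary.AllPairs using ([]; _∷_)
open import Data.List.Relation.Unary.Unique.Propositional using (Unique)
open import Data.List.Relation.Unary.Any using (here; there)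
open import Data.List.Membership.Propositional using (_∈_)
open import Data.List.Membership.Propositional.Properties using (∈-filter⁺)
open import Data.List.Relation.Binary.Subset.Propositional using (_⊆_)
import Data.List.Relation.Binary.Subset.Propositional.Properties as ⊆
open import Data.Product using (_×_; _,_; proj₁; proj₂)
open import Function.Bundles using (Equivalence)
open import Relation.Nullary using (¬?)
open import Relation.Binary.PropositionalEquality using (_≡_; _≢_; refl; sym; trans; cong; cong₂)

-- Propositional formulae over n metavariables, with the same derived
-- connectives as Defs, so that instantiation commutes with them
-- definitionally.
infixr 5 _∧ₛ_
infixr 4 _∨ₛ_
infixr 3 _⇒ₛ_

data Schema (n : ℕ) : Set where
  var  : Fin n → Schema n
  ¬ₛ_  : Schema n → Schema n
  _∧ₛ_ : Schema n → Schema n → Schema n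

_∨ₛ_ : ∀ {n} → Schema n → Schema n → Schema n
P ∨ₛ Q = ¬ₛ (¬ₛ P ∧ₛ ¬ₛ Q)

_⇒ₛ_ : ∀ {n} → Schema n → Schema n → Schema n
P ⇒ₛ Q = ¬ₛ (P ∧ₛ ¬ₛ Q)

a : ∀ {n} → Schema (1 + n)
a = var zero

b : ∀ {n} → Schema (2 + n)
b = var (suc zero)

c : ∀ {n} → Schema (3 + n)
c = var (suc (suc zero))

d : ∀ {n} → Schema (4 + n)
d = var (suc (suc (suc zero)))

e : ∀ {n} → Schema (5 + n)
e = var (suc (suc (suc (suc zero))))

⟦_⟧ : ∀ {n} → Schema n → Vec Bool n → Bool
⟦ var i ⟧ ρ = lookup ρ i
⟦ ¬ₛ P ⟧ ρ = not (⟦ P ⟧ ρ)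
⟦ P ∧ₛ Q ⟧ ρ = ⟦ P ⟧ ρ ∧ ⟦ Q ⟧ ρ

allTrue : ∀ n → (Vec Bool n → Bool) → Bool
allTrue zero f = f []
allTrue (suc n) f = allTrue n (λ ρ → f (true ∷ ρ)) ∧ allTrue n (λ ρ → f (false ∷ ρ))

allTrue-sound : ∀ n f → T (allTrue n f) → ∀ ρ → T (f ρ)
allTrue-sound zero f h [] = h
allTrue-sound (suc n) f h (true ∷ ρ) = allTrue-sound n _ (proj₁ (Equivalence.to T-∧ h)) ρ
allTrue-sound (suc n) f h (false ∷ ρ) = allTrue-sound n _ (proj₂ (Equivalence.to T-∧ h)) ρ

valid : ∀ {n} → Schema n → Bool
valid P = allTrue _ ⟦ P ⟧

inst : ∀ {n} → Vec Form n → Schema n → Form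
inst σ (var i) = lookup σ i
inst σ (¬ₛ P) = ¬' inst σ P
inst σ (P ∧ₛ Q) = inst σ P ∧' inst σ Q

evalB-inst : ∀ {n} (v : Form → Bool) (σ : Vec Form n) (P : Schema n) →
             evalB v (inst σ P) ≡ ⟦ P ⟧ (Vec.map (evalB v) σ)
evalB-inst v σ (var i) = sym (lookup-map i (evalB v) σ)
evalB-inst v σ (¬ₛ P) = cong not (evalB-inst v σ P)
evalB-inst v σ (P ∧ₛ Q) = cong₂ _∧_ (evalB-inst v σ P) (evalB-inst v σ Q)

-- Every instance of a valid schema is derivable; validity is checked by
-- computation, so the implicit proof is found automatically.
by-tautology : ∀ {n} (σ : Vec Form n) (P : Schema n) → {T (valid P)} → ⊢⁻ inst σ P
by-tautology σ P {ok} = taut λ v →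
  trans (evalB-inst v σ P)
        (Equivalence.to T-≡ (allTrue-sound _ ⟦ P ⟧ ok (Vec.map (evalB v) σ)))

⇒-refl : ∀ {A} → ⊢⁻ A ⇒ A
⇒-refl {A} = by-tautology (A ∷ []) (a ⇒ₛ a)

⇒-trans : ∀ {A B C} → ⊢⁻ A ⇒ B → ⊢⁻ B ⇒ C → ⊢⁻ A ⇒ C
⇒-trans {A} {B} {C} p q = mp q (mp p (by-tautology (A ∷ B ∷ C ∷ [])
  ((a ⇒ₛ b) ⇒ₛ (b ⇒ₛ c) ⇒ₛ a ⇒ₛ c)))

∧-intro : ∀ {A B C} → ⊢⁻ A ⇒ B → ⊢⁻ A ⇒ C → ⊢⁻ A ⇒ B ∧' C
∧-intro {A} {B} {C} p q = mp q (mp p (by-tautology (A ∷ B ∷ C ∷ [])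
  ((a ⇒ₛ b) ⇒ₛ (a ⇒ₛ c) ⇒ₛ a ⇒ₛ b ∧ₛ c)))

∧-proj₁ : ∀ {A B} → ⊢⁻ A ∧' B ⇒ A
∧-proj₁ {A} {B} = by-tautology (A ∷ B ∷ []) (a ∧ₛ b ⇒ₛ a)

∧-proj₂ : ∀ {A B} → ⊢⁻ A ∧' B ⇒ B
∧-proj₂ {A} {B} = by-tautology (A ∷ B ∷ []) (a ∧ₛ b ⇒ₛ b)

⇔-to : ∀ {A B} → ⊢⁻ A ⇔ B → ⊢⁻ A ⇒ B
⇔-to {A} {B} p = mp p (by-tautology (A ∷ B ∷ []) ((a ⇒ₛ b) ∧ₛ (b ⇒ₛ a) ⇒ₛ a ⇒ₛ b))

∨-mono : ∀ {A B C D} → ⊢⁻ A ⇒ C → ⊢⁻ B ⇒ D → ⊢⁻ A ∨' B ⇒ C ∨' D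
∨-mono {A} {B} {C} {D} p q = mp q (mp p (by-tautology (A ∷ B ∷ C ∷ D ∷ [])
  ((a ⇒ₛ c) ⇒ₛ (b ⇒ₛ d) ⇒ₛ a ∨ₛ b ⇒ₛ c ∨ₛ d)))

contrapose : ∀ {Φ A B} → ⊢⁻ A ⇒ B → ⊢⁻ Φ ⇒ ¬' B → ⊢⁻ Φ ⇒ ¬' A
contrapose {Φ} {A} {B} p q = mp q (mp p (by-tautology (Φ ∷ A ∷ B ∷ [])
  ((b ⇒ₛ c) ⇒ₛ (a ⇒ₛ ¬ₛ c) ⇒ₛ a ⇒ₛ ¬ₛ b)))

¬∨-intro : ∀ {Φ A B} → ⊢⁻ Φ ⇒ ¬' A → ⊢⁻ Φ ⇒ ¬' B → ⊢⁻ Φ ⇒ ¬' (A ∨' B)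
¬∨-intro {Φ} {A} {B} p q = mp q (mp p (by-tautology (Φ ∷ A ∷ B ∷ [])
  ((a ⇒ₛ ¬ₛ b) ⇒ₛ (a ⇒ₛ ¬ₛ c) ⇒ₛ a ⇒ₛ ¬ₛ (b ∨ₛ c))))

disjunctive-syllogism : ∀ {Φ A B} → ⊢⁻ Φ ⇒ A ∨' B → ⊢⁻ Φ ⇒ ¬' B → ⊢⁻ Φ ⇒ A
disjunctive-syllogism {Φ} {A} {B} p q = mp q (mp p (by-tautology (Φ ∷ A ∷ B ∷ [])
  ((a ⇒ₛ b ∨ₛ c) ⇒ₛ (a ⇒ₛ ¬ₛ c) ⇒ₛ a ⇒ₛ b)))

¬¬-intro : ∀ {A} → ⊢⁻ A ⇒ ¬' ¬' A
¬¬-intro {A} = by-tautology (A ∷ []) (a ⇒ₛ ¬ₛ ¬ₛ a)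

¬¬-elim : ∀ {A} → ⊢⁻ ¬' ¬' A ⇒ A
¬¬-elim {A} = by-tautology (A ∷ []) (¬ₛ ¬ₛ a ⇒ₛ a)

excluded-middle : ∀ {Φ A} → ⊢⁻ Φ ⇒ A ∨' ¬' A
excluded-middle {Φ} {A} = by-tautology (Φ ∷ A ∷ []) (a ⇒ₛ b ∨ₛ ¬ₛ b)

de-Morgan : ∀ {A B} → ⊢⁻ ¬' (A ∧' B) ⇒ ¬' A ∨' ¬' B
de-Morgan {A} {B} = by-tautology (A ∷ B ∷ []) (¬ₛ (a ∧ₛ b) ⇒ₛ ¬ₛ a ∨ₛ ¬ₛ b)

-- ⊤' is ¬¬(0 = 0), so unlike the rules above it needs axiom (1).
⊤-intro : ∀ {A} → ⊢⁻ A ⇒ ⊤'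
⊤-intro {A} = mp (ax1 0) (by-tautology ((0 ≐ 0) ∷ A ∷ []) (a ⇒ₛ b ⇒ₛ ¬ₛ ¬ₛ a))

∗-monoʳ : ∀ {A B} F → ⊢⁻ A ⇒ B → ⊢⁻ F ∗ A ⇒ F ∗ B
∗-monoʳ {A} {B} F p = ⇒-trans (⇔-to (ax7 F A)) (⇒-trans (∗-mono F p) (⇔-to (ax7 B F)))

∗-mono₂ : ∀ {A B C D} → ⊢⁻ A ⇒ B → ⊢⁻ C ⇒ D → ⊢⁻ A ∗ C ⇒ B ∗ D
∗-mono₂ {B = B} {C} p q = ⇒-trans (∗-mono C p) (∗-monoʳ B q)

∗-cases : ∀ {A B C} F → ⊢⁻ A ⇒ B ∨' C → ⊢⁻ A ∗ F ⇒ (B ∗ F) ∨' (C ∗ F)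
∗-cases {B = B} {C} F p = ⇒-trans (∗-mono F p) (ax9 B C F)

∗-distribʳ-∨ : ∀ {A B C} → ⊢⁻ A ∗ (B ∨' C) ⇒ (A ∗ B) ∨' (A ∗ C)
∗-distribʳ-∨ {A} {B} {C} = ⇒-trans (⇔-to (ax7 A (B ∨' C)))
  (⇒-trans (ax9 B C A) (∨-mono (⇔-to (ax7 B A)) (⇔-to (ax7 C A))))

∗-⊥ʳ : ∀ {A} → ⊢⁻ A ∗ ⊥' ⇒ ⊥'
∗-⊥ʳ {A} = ⇒-trans (⇔-to (ax7 A ⊥')) (⇔-to (ax10 A))

absorbˡ : ∀ {ξ} F → ⊢⁻ ξ ∗ ⊤' ⇒ ξ → ⊢⁻ ξ ∗ F ⇒ ξ
absorbˡ {ξ} F p = ⇒-trans (∗-monoʳ ξ ⊤-intro) p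

absorbʳ : ∀ {ξ} F → ⊢⁻ ξ ∗ ⊤' ⇒ ξ → ⊢⁻ F ∗ ξ ⇒ ξ
absorbʳ {ξ} F p = ⇒-trans (⇔-to (ax7 F ξ)) (absorbˡ F p)

size≥-suc : ∀ β → ⊢⁻ ¬' emp ∗ size≥ β ⇒ size≥ (suc β)
size≥-suc zero = ax14a
size≥-suc (suc β) = ⇒-refl

size≥-step : ∀ β → ⊢⁻ size≥ (suc β) ⇒ size≥ β
size≥-step zero = ⊤-intro
size≥-step (suc β) = ⇒-trans (∗-monoʳ (¬' emp) (size≥-step β)) (size≥-suc β)

cell : PVAR → Form
cell x = alloc x ∧' size≐ 1

cell⇒¬emp : ∀ {x} → ⊢⁻ cell x ⇒ ¬' emp
cell⇒¬emp = ⇒-trans ∧-proj₂ ∧-proj₁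

cell-sole-address : ∀ x y → ⊢⁻ cell x ⇒ (x ≐ y) ∨' ¬' alloc y
cell-sole-address x y = mp (ax20 x y)
  (by-tautology (alloc x ∷ alloc y ∷ (x ≐ y) ∷ size≥ 1 ∷ size≥ 2 ∷ [])
    ((a ∧ₛ b ∧ₛ ¬ₛ c ⇒ₛ e) ⇒ₛ a ∧ₛ d ∧ₛ ¬ₛ e ⇒ₛ c ∨ₛ ¬ₛ b))

cell-frame-¬alloc : ∀ x y → ⊢⁻ cell x ∗ ¬' alloc y ⇒ (x ≐ y) ∨' ¬' alloc y
cell-frame-¬alloc x y = ⇒-trans (∗-cases (¬' alloc y) (cell-sole-address x y))
  (∨-mono (absorbˡ (¬' alloc y) (ax14b x y)) (ax15 y))

-- Under Φ, whenever the heap is the cell at x plus a rest, the rest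
-- satisfies Q.
Remains : Form → PVAR → Form → Set
Remains Φ x Q = ⊢⁻ Φ ⇒ ¬' (cell x ∗ ¬' Q)

module _ {Φ : Form} {x : PVAR} where

  Remains-⊤ : Remains Φ x ⊤'
  Remains-⊤ = contrapose (⇒-trans (∗-monoʳ (cell x) ¬¬-elim) ∗-⊥ʳ) ⊤-intro

  Remains-∧ : ∀ {Q₁ Q₂} → Remains Φ x Q₁ → Remains Φ x Q₂ → Remains Φ x (Q₁ ∧' Q₂)
  Remains-∧ r₁ r₂ =
    contrapose (⇒-trans (∗-monoʳ (cell x) de-Morgan) ∗-distribʳ-∨) (¬∨-intro r₁ r₂)

  Remains-absorbed : ∀ {ξ} → ⊢⁻ ξ ∗ ⊤' ⇒ ξ → ⊢⁻ Φ ⇒ ¬' ξ → Remains Φ x (¬' ξ)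
  Remains-absorbed absorbs h =
    contrapose (⇒-trans (∗-monoʳ (cell x) ¬¬-elim) (absorbʳ (cell x) absorbs)) h

  Remains-alloc : ∀ {y} → ⊢⁻ Φ ⇒ alloc y → ⊢⁻ Φ ⇒ ¬' (x ≐ y) → Remains Φ x (alloc y)
  Remains-alloc {y} allocated distinct =
    contrapose (cell-frame-¬alloc x y) (¬∨-intro distinct (⇒-trans allocated ¬¬-intro))

  carve : ∀ {Q} → ⊢⁻ Φ ⇒ alloc x → Remains Φ x Q → ⊢⁻ Φ ⇒ cell x ∗ Q
  carve allocated r = disjunctive-syllogism
    (⇒-trans allocated (⇒-trans (ax17 x)
      (⇒-trans (∗-monoʳ (cell x) excluded-middle) ∗-distribʳ-∨)))
    r

distinctFrom : PVAR → List PVAR → Form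
distinctFrom x Y = ⋀ (map (λ y → ¬' (x ≐ y)) Y)

Triangular : List PVAR → Form
Triangular [] = ⊤'
Triangular (y ∷ Y) = alloc y ∧' distinctFrom y Y ∧' Triangular Y

Remains-distinctFrom : ∀ {Φ x y} Y → ⊢⁻ Φ ⇒ distinctFrom y Y → Remains Φ x (distinctFrom y Y)
Remains-distinctFrom [] h = Remains-⊤
Remains-distinctFrom {y = y} (z ∷ Y) h =
  Remains-∧ (Remains-absorbed (ax14b y z) (⇒-trans h ∧-proj₁))
            (Remains-distinctFrom Y (⇒-trans h ∧-proj₂))

Remains-Triangular : ∀ {Φ x} Y → ⊢⁻ Φ ⇒ Triangular Y → ⊢⁻ Φ ⇒ distinctFrom x Y →
                     Remains Φ x (Triangular Y)
Remains-Triangular [] h x∉Y = Remains-⊤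
Remains-Triangular (y ∷ Y) h x∉Y =
  Remains-∧ (Remains-alloc (⇒-trans h ∧-proj₁) (⇒-trans x∉Y ∧-proj₁))
    (Remains-∧ (Remains-distinctFrom Y (⇒-trans h (⇒-trans ∧-proj₂ ∧-proj₁)))
               (Remains-Triangular Y (⇒-trans h (⇒-trans ∧-proj₂ ∧-proj₂))
                                     (⇒-trans x∉Y ∧-proj₂)))

-- Axiom (6) for triangular lists: peel off one cell per variable.
Triangular-size : ∀ X → ⊢⁻ Triangular X ⇒ size≥ (length X)
Triangular-size [] = ⊤-intro
Triangular-size (x ∷ Y) =
  ⇒-trans (carve ∧-proj₁ (Remains-Triangular Y (⇒-trans ∧-proj₂ ∧-proj₂)
                                                (⇒-trans ∧-proj₂ ∧-proj₁)))
    (⇒-trans (∗-mono₂ cell⇒¬emp (Triangular-size Y)) (size≥-suc (length Y)))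

⋀-member : ∀ {k} K → k ∈ K → ⊢⁻ ⋀ K ⇒ k
⋀-member (k ∷ K) (here refl) = ∧-proj₁
⋀-member (k ∷ K) (there k∈K) = ⇒-trans ∧-proj₂ (⋀-member K k∈K)

⋀-⊆ : ∀ K M → M ⊆ K → ⊢⁻ ⋀ K ⇒ ⋀ M
⋀-⊆ K [] M⊆K = ⊤-intro
⋀-⊆ K (m ∷ M) M⊆K = ∧-intro (⋀-member K (M⊆K (here refl))) (⋀-⊆ K M (λ p → M⊆K (there p)))

⊆-without : ∀ {x X L} → All (x ≢_) X → X ⊆ L → X ⊆ without x L
⊆-without {x} x∉X X⊆L z∈X =
  ∈-filter⁺ (λ y → ¬? (y ≟ x)) (X⊆L z∈X) (λ z≡x → All.lookup x∉X z∈X (sym z≡x))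

allocDistinctFrom : List PVAR → PVAR → Form
allocDistinctFrom L x = alloc x ∧' distinctFrom x (without x L)

-- For duplicate-free X ⊆ L, the conjuncts for X imply the triangular form:
-- the later variables of X form a subset of L ∖ {x}.
allocDistinct⇒Triangular : ∀ L X → Unique X → X ⊆ L →
                           ⊢⁻ ⋀ (map (allocDistinctFrom L) X) ⇒ Triangular X
allocDistinct⇒Triangular L [] [] X⊆L = ⊤-intro
allocDistinct⇒Triangular L (x ∷ X) (x∉X ∷ unique) x∷X⊆L =
  ∧-intro (⇒-trans ∧-proj₁ ∧-proj₁)
    (∧-intro (⇒-trans ∧-proj₁ (⇒-trans ∧-proj₂ (⋀-⊆ _ _ later-distinct)))
             (⇒-trans ∧-proj₂ (allocDistinct⇒Triangular L X unique X⊆L)))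
  where
  X⊆L : X ⊆ L
  X⊆L p = x∷X⊆L (there p)

  later-distinct : map (λ y → ¬' (x ≐ y)) X ⊆ map (λ y → ¬' (x ≐ y)) (without x L)
  later-distinct = ⊆.map⁺ (λ y → ¬' (x ≐ y)) (⊆-without x∉X X⊆L)

lemma5p3 : (∀ (β : ℕ) → ⊢⁻ size≥ (suc β) ⇒ size≥ β)
    × (∀ (X : List PVAR) → Unique X → ⊢⁻ allocDistinct X ⇒ size≥ (length X))
lemma5p3 = size≥-step , axiom6
  where
  axiom6 : ∀ X → Unique X → ⊢⁻ allocDistinct X ⇒ size≥ (length X)
  axiom6 X unique =
    ⇒-trans (allocDistinct⇒Triangular X X unique ⊆.⊆-refl) (Triangular-size X)
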